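{- For every $k\in\mathbb{N}$ there is $\ell=\ell(k)$ such that for every $N$, if $U$ and $T$ are two disjoint subsets of $2[N]=\{2,4,\dots,2N\}$ with $|U|=|T|=\ell$, then there exist $X\subset U$ and $Y\subset T$ with $|X|=|Y|=k$ and $X\cup Y$ admissible.
   Context: A finite set of integers is admissible if for every prime $p$ its elements do not cover all residue classes mod $p$. -}

module Defs where

open import Data.Nat using (ℕ; suc; _<_; _≤_; _*_; NonZero)
open import Data.Nat.DivMod using (_%_)
open import Data.Nat.Primality using (Prime; prime⇒nonZero)
open import Data.Product using (Σ; _×_; ∃-syntax)
open import Data.List using (List; length; _++_)
open import Data.List.Membership.Propositional using (_∈_)
open import Data.List.Relation.Unary.All using (All)
open import Data.List.Relation.Unary.Unique.Propositional using (Unique)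
open import Relation.Binary.PropositionalEquality using (_≡_; _≢_)
open import Relation.Nullary using (¬_)

-- A finite set of integers is represented by a duplicate-free list.
-- All sets in the statement live inside 2[N] ⊆ ℕ⁺, so ℕ suffices.

CoversAllResidues : (p : ℕ) → .{{_ : NonZero p}} → List ℕ → Set
CoversAllResidues p S = ∀ r → r < p → Σ ℕ λ x → x ∈ S × x % p ≡ r

Admissible : List ℕ → Set
Admissible S = ∀ p → (pp : Prime p) → ¬ CoversAllResidues p {{prime⇒nonZero pp}} S

In2N : ℕ → ℕ → Set
In2N N x = Σ ℕ λ m → (1 ≤ m) × (m ≤ N) × (x ≡ 2 * m)

Subset : List ℕ → List ℕ → Set
Subset X U = All (λ x → x ∈ U) X

Disjoint : List ℕ → List ℕ → Set
Disjoint U T = All (λ x → ¬ (x ∈ T)) U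

{-# OPTIONS --safe #-}
module Submission where

-- Put Q = (2k)! and ℓ = Qk + 1. By pigeonhole, k elements of U lie in one
-- residue class a mod Q and k elements of T in one class b mod Q; let X, Y be
-- these. X ∪ Y consists of even numbers, so it misses the odd class mod 2.
-- An odd prime p ≤ 2k divides Q, so X ∪ Y meets only the two classes a, b
-- mod p, fewer than p ≥ 3. A prime p > 2k exceeds the size of X ∪ Y.

open import Defs
open import Data.Nat using (ℕ; zero; suc; _+_; _*_; _<_; _≤_; _≤?_; z≤n; s≤s; z<s; s<s; NonZero; _≟_; _!)
open import Data.Nat.Properties
open import Data.Nat.DivMod using (_%_; m%n<n; m*n%n≡0; m∣n⇒o%n%m≡o%m)
open import Data.Nat.Divisibility using (_∣_; m∣m*n; ∣-trans; m≤n⇒m!∣n!)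
open import Data.Nat.Primality using (prime⇒nonZero; prime⇒nonTrivial)
open import Data.Nat.Base using (nonTrivial⇒n>1)
open import Data.Fin using (Fin; toℕ)
open import Data.Fin.Properties using (pigeonhole; toℕ<n)
open import Data.Product using (Σ; ∃-syntax; _×_; _,_; proj₁; proj₂)
open import Data.Sum as Sum using (_⊎_; inj₁; inj₂)
open import Data.Empty using (⊥)
open import Data.Bool using (true; false)
open import Data.List using (List; []; _∷_; length; _++_; lookup; filter; take)
open import Data.List.Properties using (length-++; length-take)
open import Data.List.Relation.Unary.All as All using (All; []; _∷_)
open import Data.List.Relation.Unary.All.Properties as Allₚ using (++⁺; all-filter)
open import Data.List.Relation.Unary.Any using (index)
open import Data.List.Relation.Unary.Any.Properties using (lookup-index)
open import Data.List.Relation.Unary.AllPairs using ([]; _∷_)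
open import Data.List.Relation.Unary.Unique.Propositional using (Unique)
open import Data.List.Relation.Binary.Sublist.Propositional using (_⊆_; []; _∷_; _∷ʳ_; ⊆-trans)
open import Data.List.Relation.Binary.Sublist.Propositional.Properties
  using (All-resp-⊆; take-⊆; filter-⊆; filter⁺; length-mono-≤)
open import Relation.Binary.PropositionalEquality using (_≡_; refl; sym; trans; cong; cong₂)
open import Relation.Nullary using (¬_; yes; no; does)
open import Relation.Unary using (Decidable)
open import Relation.Unary.Properties using (∁?)

private variable
  A : Set

Unique-resp-⊆ : ∀ {xs ys : List A} → xs ⊆ ys → Unique ys → Unique xs
Unique-resp-⊆ []        []         = []
Unique-resp-⊆ (y ∷ʳ τ)  (_ ∷ u)    = Unique-resp-⊆ τ u
Unique-resp-⊆ (refl ∷ τ) (y∉ ∷ u)  = All-resp-⊆ τ y∉ ∷ Unique-resp-⊆ τ u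

⊆⇒Subset : ∀ {xs ys} → xs ⊆ ys → Subset xs ys
⊆⇒Subset τ = All-resp-⊆ τ (All.tabulate (λ y∈ → y∈))

length-filter+filter-∁ : ∀ {P : A → Set} (P? : Decidable P) xs →
  length (filter P? xs) + length (filter (∁? P?) xs) ≡ length xs
length-filter+filter-∁ P? []       = refl
length-filter+filter-∁ P? (x ∷ xs) with does (P? x)
... | true  = cong suc (length-filter+filter-∁ P? xs)
... | false = trans (+-suc _ _) (cong suc (length-filter+filter-∁ P? xs))

fibre : (A → ℕ) → ℕ → List A → List A
fibre f r = filter (λ x → f x ≟ r)

large-fibre : ∀ {A : Set} (f : A → ℕ) Q k xs → All (λ x → f x < Q) xs → Q * k < length xs →
  ∃[ r ] k ≤ length (fibre f r xs)
large-fibre f zero    k (x ∷ xs) (() ∷ _) _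
large-fibre {A} f (suc Q) k xs bounded long with k ≤? length (fibre f Q xs)
... | yes k≤fibre = Q , k≤fibre
... | no  k≰fibre with large-fibre f Q k rest rest-bounded rest-long
  where
  rest : List A
  rest = filter (∁? (λ x → f x ≟ Q)) xs
  rest-bounded : All (λ x → f x < Q) rest
  rest-bounded = All.zipWith (λ (lt , ≢Q) → ≤∧≢⇒< (≤-pred lt) ≢Q)
    (Allₚ.filter⁺ _ bounded , all-filter _ xs)
  rest-long : Q * k < length rest
  rest-long = ≰⇒> λ rest≤ → <⇒≱ long (begin
    length xs                                 ≡⟨ sym (length-filter+filter-∁ _ xs) ⟩
    length (fibre f Q xs) + length rest       ≤⟨ +-mono-≤ (<⇒≤ (≰⇒> k≰fibre)) rest≤ ⟩
    k + Q * k                                 ∎)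
    where open ≤-Reasoning
... | r , k≤ = r , ≤-trans k≤ (length-mono-≤ (filter⁺ _ _ (λ { refl p → p }) (filter-⊆ _ xs)))

residue-class : ∀ k Q .{{_ : NonZero Q}} xs → Q * k < length xs →
  ∃[ r ] ∃[ ys ] ys ⊆ xs × length ys ≡ k × All (λ y → y % Q ≡ r) ys
residue-class k Q xs long
  with r , k≤ ← large-fibre (_% Q) Q k xs (All.universal (λ x → m%n<n x Q) xs) long =
  r , take k (fibre (_% Q) r xs) ,
  ⊆-trans (take-⊆ k _) (filter-⊆ _ xs) ,
  trans (length-take k _) (m≤n⇒m⊓n≡m k≤) ,
  Allₚ.take⁺ k (all-filter _ xs)

covers⇒≤length : ∀ p .{{_ : NonZero p}} S → CoversAllResidues p S → p ≤ length S
covers⇒≤length p S covers = ≮⇒≥ λ short →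
  let i , j , i<j , same = pigeonhole short position
  in <-irrefl (trans (sym (hit i)) (trans (cong (λ t → lookup S t % p) same) (hit j))) i<j
  where
  position : Fin p → Fin (length S)
  position i = index (proj₁ (proj₂ (covers (toℕ i) (toℕ<n i))))
  hit : ∀ i → lookup S (position i) % p ≡ toℕ i
  hit i with covers (toℕ i) (toℕ<n i)
  ... | x , x∈ , x%p = trans (cong (_% p) (sym (lookup-index x∈))) x%p

Even : ℕ → Set
Even x = ∃[ m ] x ≡ 2 * m

In2N⇒Even : ∀ {N x} → In2N N x → Even x
In2N⇒Even (m , _ , _ , x≡2m) = m , x≡2m

evens-¬cover-2 : ∀ {S} → All Even S → ¬ CoversAllResidues 2 S
evens-¬cover-2 evens covers with x , x∈ , x%2≡1 ← covers 1 ≤-refl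
  with m , refl ← All.lookup evens x∈ =
  0≢1+n (trans (sym (trans (cong (_% 2) (*-comm 2 m)) (m*n%n≡0 m 2))) x%2≡1)

three-not-in-pair : ∀ {a b : ℕ} → (0 ≡ a ⊎ 0 ≡ b) → (1 ≡ a ⊎ 1 ≡ b) → (2 ≡ a ⊎ 2 ≡ b) → ⊥
three-not-in-pair (inj₁ refl) (inj₁ ())   _
three-not-in-pair (inj₁ refl) (inj₂ refl) (inj₁ ())
three-not-in-pair (inj₁ refl) (inj₂ refl) (inj₂ ())
three-not-in-pair (inj₂ refl) (inj₁ refl) (inj₁ ())
three-not-in-pair (inj₂ refl) (inj₁ refl) (inj₂ ())
three-not-in-pair (inj₂ refl) (inj₂ ())   _

two-classes-¬cover : ∀ p .{{_ : NonZero p}} a b S → 2 < p →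
  All (λ x → x % p ≡ a ⊎ x % p ≡ b) S → ¬ CoversAllResidues p S
two-classes-¬cover p a b S 2<p classes covers =
  three-not-in-pair (class 0 (<-trans z<s 2<p)) (class 1 (<-trans (s<s z<s) 2<p)) (class 2 2<p)
  where
  class : ∀ r → r < p → r ≡ a ⊎ r ≡ b
  class r r<p with x , x∈ , x%p≡r ← covers r r<p =
    Sum.map (trans (sym x%p≡r)) (trans (sym x%p≡r)) (All.lookup classes x∈)

%-coarsen : ∀ {p m} .{{_ : NonZero p}} .{{_ : NonZero m}} {x a} →
  p ∣ m → x % m ≡ a → x % p ≡ a % p
%-coarsen {p} {m} {x} p∣m x%m≡a = trans (sym (m∣n⇒o%n%m≡o%m p m x p∣m)) (cong (_% p) x%m≡a)

∣! : ∀ {q n} → 0 < q → q ≤ n → q ∣ n !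
∣! {suc _} _ q≤n = ∣-trans (m∣m*n _) (m≤n⇒m!∣n! q≤n)

two-classes-admissible : ∀ m .{{_ : NonZero m}} n a b S →
  (∀ {q} → 0 < q → q ≤ n → q ∣ m) → All Even S → length S ≤ n →
  All (λ x → x % m ≡ a ⊎ x % m ≡ b) S → Admissible S
two-classes-admissible m n a b S ≤n⇒∣m evens |S|≤n classes p p-prime =
  ¬cover p {{prime⇒nonZero p-prime}} (nonTrivial⇒n>1 p {{prime⇒nonTrivial p-prime}})
  where
  ¬cover : ∀ q .{{_ : NonZero q}} → 1 < q → ¬ CoversAllResidues q S
  ¬cover 1 (s≤s ())
  ¬cover 2 _ = evens-¬cover-2 evens
  ¬cover q@(suc (suc (suc _))) _ with q ≤? n
  ... | yes q≤n = two-classes-¬cover q (a % q) (b % q) S (s≤s (s≤s (s≤s z≤n)))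
    (All.map (Sum.map (%-coarsen q∣m) (%-coarsen q∣m)) classes)
    where
    q∣m : q ∣ m
    q∣m = ≤n⇒∣m z<s q≤n
  ... | no q≰n = λ covers → q≰n (≤-trans (covers⇒≤length q S covers) |S|≤n)

lemma4p2 : (k : ℕ) → Σ ℕ λ ℓ → (N : ℕ) → (U T : List ℕ) →
    Unique U → Unique T → All (In2N N) U → All (In2N N) T → Disjoint U T →
    length U ≡ ℓ → length T ≡ ℓ →
    Σ (List ℕ) λ X → Σ (List ℕ) λ Y →
      Unique X × Unique Y × Subset X U × Subset Y T ×
      length X ≡ k × length Y ≡ k × Admissible (X ++ Y)
lemma4p2 k = suc (Q * k) , λ N U T U-unique T-unique U⊆2N T⊆2N _ |U| |T| →
  let a , X , X⊆U , |X| , X≡a = residue-class k Q U (≤-reflexive (sym |U|))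
      b , Y , Y⊆T , |Y| , Y≡b = residue-class k Q T (≤-reflexive (sym |T|))
      evens = ++⁺ (All.map In2N⇒Even (All-resp-⊆ X⊆U U⊆2N))
                  (All.map In2N⇒Even (All-resp-⊆ Y⊆T T⊆2N))
      |X++Y| = trans (length-++ X) (cong₂ _+_ |X| |Y|)
  in X , Y , Unique-resp-⊆ X⊆U U-unique , Unique-resp-⊆ Y⊆T T-unique ,
     ⊆⇒Subset X⊆U , ⊆⇒Subset Y⊆T , |X| , |Y| ,
     two-classes-admissible Q (k + k) a b (X ++ Y) ∣! evens (≤-reflexive |X++Y|)
       (++⁺ (All.map inj₁ X≡a) (All.map inj₂ Y≡b))
  where
  Q : ℕ
  Q = (k + k) !
  instance
    Q-nonZero : NonZero Q
    Q-nonZero = (k + k) !≢0
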